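{- For any zigzag strategy with defining sequence $(u_i)_{i\ge0}$ and known initial distance $d\ge1$, for all $i\ge0$, $s_i\ge d\prod_{n=0}^{i}u_n$.
   Context: Search model: a robot starts at the origin of the real line at time $0$ with maximum speed $1$. A target starts at distance $d\ge1$ from the origin (on one of two sides) and moves away from the origin at constant speed $v\in[0,1)$; its evasiveness is $u=\frac1{1-v}$, $v=1-\frac1u$. A zigzag strategy is given by a sequence $(u_i)_{i\ge0}$ of evasiveness values ($u_i\ge1$) with $u_{i+2}>u_i$ for all $i\ge0$ and $u_i\to\infty$; the motion is divided into rounds $i=0,1,2,\dots$: in round $i$ the robot travels at speed $1$ from the origin to position $(-1)^i x_i$ and back to the origin, where $x_i$ is the distance just large enough to catch (become collocated with) the target of evasiveness $u_i$ on side $(-1)^i$. Set $s_i=\sum_{n=0}^i x_n$ for $i\ge -1$ (so $s_{ -1}=0$). -}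

module Defs where

open import Level using (Level; _⊔_; suc)
open import Data.Nat using (ℕ; zero) renaming (suc to 1+_; _≤_ to _≤ℕ_)
open import Data.Product using (Σ; ∃; _×_)
open import Relation.Nullary using (¬_)
open import Relation.Binary using (Rel; IsTotalOrder)
open import Algebra.Bundles using (CommutativeRing)

-- An ordered field (the reals are an instance).  The statement is
-- quantified over every ordered field, so in particular it covers ℝ.
record OrderedField (c ℓ₁ ℓ₂ : Level) : Set (suc (c ⊔ ℓ₁ ⊔ ℓ₂)) where
  field
    commRing : CommutativeRing c ℓ₁
  open CommutativeRing commRing public
  field
    _≤_            : Rel Carrier ℓ₂
    isTotalOrder   : IsTotalOrder _≈_ _≤_
    +-mono-≤       : ∀ {x y} z → x ≤ y → (x + z) ≤ (y + z)
    *-nonneg       : ∀ {x y} → 0# ≤ x → 0# ≤ y → 0# ≤ (x * y)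
    nontrivial     : ¬ (1# ≈ 0#)
    inverse        : ∀ x → ¬ (x ≈ 0#) → Σ Carrier (λ y → (x * y) ≈ 1#)

  _<_ : Rel Carrier (ℓ₁ ⊔ ℓ₂)
  x < y = (x ≤ y) × ¬ (x ≈ y)

module Search {c ℓ₁ ℓ₂} (F : OrderedField c ℓ₁ ℓ₂) where
  open OrderedField F hiding (zero)

  2# : Carrier
  2# = 1# + 1#

  partialSum : (ℕ → Carrier) → ℕ → Carrier
  partialSum x zero = x zero
  partialSum x (1+ i) = partialSum x i + x (1+ i)

  -- s_{i-1} (with s_{-1} = 0)
  sBefore : (ℕ → Carrier) → ℕ → Carrier
  sBefore x zero = 0#
  sBefore x (1+ i) = partialSum x i

  prodUpTo : (ℕ → Carrier) → ℕ → Carrier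
  prodUpTo u zero = u zero
  prodUpTo u (1+ i) = prodUpTo u i * u (1+ i)

  -- v is the speed of the target of evasiveness u, i.e. u = 1/(1-v)
  SpeedOf : Carrier → Carrier → Set ℓ₁
  SpeedOf u v = (u * (1# - v)) ≈ 1#

  -- A round starting (at the origin) at time T, going out to distance y on
  -- the target's side at speed 1: the robot is at distance t from the origin
  -- at time T + t (0 ≤ t ≤ y).  The target (initial distance d, speed v)
  -- is at distance d + v (T + t).  Catching = becoming collocated.
  Catches : Carrier → Carrier → Carrier → Carrier → Set (c ⊔ ℓ₁ ⊔ ℓ₂)
  Catches d v T y = ∃ λ t → (0# ≤ t) × (t ≤ y) × (t ≈ (d + v * (T + t)))

  IsCatchDistance : Carrier → Carrier → Carrier → Carrier → Set (c ⊔ ℓ₁ ⊔ ℓ₂)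
  IsCatchDistance d v T x =
    (0# ≤ x) × Catches d v T x × (∀ y → Catches d v T y → x ≤ y)

  IsZigzagSequence : (ℕ → Carrier) → Set (c ⊔ ℓ₁ ⊔ ℓ₂)
  IsZigzagSequence u =
    (∀ i → 1# ≤ u i)
    × (∀ i → u i < u (1+ (1+ i)))
    × (∀ M → ∃ λ N → ∀ i → N ≤ℕ i → M ≤ u i)

{-# OPTIONS --safe #-}
-- In round i the robot leaves the origin at time 2 s_{i-1} and meets the target
-- at the distance t solving t = d + v_i (2 s_{i-1} + t), namely
-- t = u_i (d + 2 v_i s_{i-1}).  Since x_i ≥ t and u_i v_i = u_i - 1 ≥ 0, this
-- gives s_i = s_{i-1} + x_i ≥ u_i (s_{i-1} + d), and induction on i turns
-- these recurrences into s_i ≥ d u_0 ⋯ u_i.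
module Submission where

open import Defs
open import Data.Nat using (ℕ; zero; suc)
open import Data.Product using (_×_; _,_; proj₁)
open import Data.Sum using (inj₁; inj₂)
open import Relation.Binary.Bundles using (TotalOrder)
import Algebra.Properties.Group as GroupProperties
import Algebra.Properties.Ring as RingProperties
import Algebra.Solver.Ring.NaturalCoefficients.Default as SemiringSolver
import Relation.Binary.Reasoning.PartialOrder as PartialOrderReasoning
import Relation.Binary.Reasoning.Setoid as SetoidReasoning

module OrderedFieldProperties {c ℓ₁ ℓ₂} (F : OrderedField c ℓ₁ ℓ₂) where
  open OrderedField F hiding (zero)
  open RingProperties ring using (x[y-z]≈xy-xz; -1*x≈-x; -‿involutive)
  open GroupProperties +-group public using (//-rightDividesˡ)
    renaming (∙-cancelʳ to +-cancelʳ)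

  totalOrder : TotalOrder c ℓ₁ ℓ₂
  totalOrder = record { isTotalOrder = isTotalOrder }

  open TotalOrder totalOrder public using (poset; total)
    renaming (refl to ≤-refl; trans to ≤-trans)

  module ≤-Reasoning = PartialOrderReasoning poset

  +-monoʳ-≤ : ∀ z {x y} → x ≤ y → (z + x) ≤ (z + y)
  +-monoʳ-≤ z {x} {y} x≤y = begin
    z + x  ≈⟨ +-comm z x ⟩
    x + z  ≤⟨ +-mono-≤ z x≤y ⟩
    y + z  ≈⟨ +-comm y z ⟩
    z + y  ∎
    where open ≤-Reasoning

  x≤x+y : ∀ {x y} → 0# ≤ y → x ≤ (x + y)
  x≤x+y {x} {y} 0≤y = begin
    x       ≈⟨ +-identityʳ x ⟨
    x + 0#  ≤⟨ +-monoʳ-≤ x 0≤y ⟩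
    x + y   ∎
    where open ≤-Reasoning

  x≤y⇒0≤y-x : ∀ {x y} → x ≤ y → 0# ≤ (y - x)
  x≤y⇒0≤y-x {x} {y} x≤y = begin
    0#     ≈⟨ -‿inverseʳ x ⟨
    x - x  ≤⟨ +-mono-≤ (- x) x≤y ⟩
    y - x  ∎
    where open ≤-Reasoning

  0≤y-x⇒x≤y : ∀ {x y} → 0# ≤ (y - x) → x ≤ y
  0≤y-x⇒x≤y {x} {y} 0≤y-x = begin
    x          ≈⟨ +-identityˡ x ⟨
    0# + x     ≤⟨ +-mono-≤ x 0≤y-x ⟩
    y - x + x  ≈⟨ //-rightDividesˡ x y ⟩
    y          ∎
    where open ≤-Reasoning

  *-monoˡ-≤-nonneg : ∀ {z x y} → 0# ≤ z → x ≤ y → (z * x) ≤ (z * y)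
  *-monoˡ-≤-nonneg {z} {x} {y} 0≤z x≤y = 0≤y-x⇒x≤y (begin
    0#             ≤⟨ *-nonneg 0≤z (x≤y⇒0≤y-x x≤y) ⟩
    z * (y - x)    ≈⟨ x[y-z]≈xy-xz z y x ⟩
    z * y - z * x  ∎)
    where open ≤-Reasoning

  0≤1 : 0# ≤ 1#
  0≤1 with total 0# 1#
  ... | inj₁ 0≤1 = 0≤1
  ... | inj₂ 1≤0 = begin
    0#            ≤⟨ *-nonneg 0≤-1 0≤-1 ⟩
    - 1# * - 1#   ≈⟨ -1*x≈-x (- 1#) ⟩
    - - 1#        ≈⟨ -‿involutive 1# ⟩
    1#            ∎
    where
    open ≤-Reasoning
    0≤-1 : 0# ≤ (- 1#)
    0≤-1 = begin
      0#      ≤⟨ x≤y⇒0≤y-x 1≤0 ⟩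
      0# - 1# ≈⟨ +-identityˡ (- 1#) ⟩
      - 1#    ∎

module ZigzagSearchProperties {c ℓ₁ ℓ₂} (F : OrderedField c ℓ₁ ℓ₂) where
  open OrderedField F hiding (zero)
  open Search F
  open OrderedFieldProperties F
  open SemiringSolver commutativeSemiring using (solve; _:+_; _:*_; _:=_; con)

  SpeedOf⇒u≈1+uv : ∀ {u v} → SpeedOf u v → u ≈ 1# + u * v
  SpeedOf⇒u≈1+uv {u} {v} speed = begin
    u                        ≈⟨ *-identityʳ u ⟨
    u * 1#                   ≈⟨ *-congˡ (//-rightDividesˡ v 1#) ⟨
    u * ((1# - v) + v)       ≈⟨ distribˡ u (1# - v) v ⟩
    u * (1# - v) + u * v     ≈⟨ +-congʳ speed ⟩
    1# + u * v               ∎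
    where open SetoidReasoning setoid

  catchTime≈ : ∀ {u v d T t} → SpeedOf u v → t ≈ d + v * (T + t) →
               t ≈ u * (d + v * T)
  catchTime≈ {u} {v} {d} {T} {t} speed meets = +-cancelʳ (u * v * t) t _ (begin
    t + u * v * t            ≈⟨ solve 3 (λ u v t → t :+ u :* v :* t := (con 1 :+ u :* v) :* t) refl u v t ⟩
    (1# + u * v) * t         ≈⟨ *-congʳ (SpeedOf⇒u≈1+uv speed) ⟨
    u * t                    ≈⟨ *-congˡ meets ⟩
    u * (d + v * (T + t))    ≈⟨ solve 5 (λ u v d T t → u :* (d :+ v :* (T :+ t)) := u :* (d :+ v :* T) :+ u :* v :* t) refl u v d T t ⟩
    u * (d + v * T) + u * v * t ∎)
    where open SetoidReasoning setoid

  Catches⇒catchTime≤ : ∀ {u v d T y} → SpeedOf u v → Catches d v T y →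
                       (u * (d + v * T)) ≤ y
  Catches⇒catchTime≤ {u} {v} {d} {T} {y} speed (t , _ , t≤y , meets) = begin
    u * (d + v * T)  ≈⟨ catchTime≈ speed meets ⟨
    t                ≤⟨ t≤y ⟩
    y                ∎
    where open ≤-Reasoning

  u[S+d]≤S+X : ∀ {u v d S X} → 0# ≤ u → 0# ≤ v → SpeedOf u v → 0# ≤ S →
               Catches d v (2# * S) X → (u * (S + d)) ≤ (S + X)
  u[S+d]≤S+X {u} {v} {d} {S} {X} 0≤u 0≤v speed 0≤S catches = begin
    u * (S + d)                          ≤⟨ x≤x+y (*-nonneg (*-nonneg 0≤u 0≤v) 0≤S) ⟩
    u * (S + d) + u * v * S              ≈⟨ solve 4 (λ u v d S → u :* (S :+ d) :+ u :* v :* S := u :* S :+ u :* d :+ u :* v :* S) refl u v d S ⟩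
    u * S + u * d + u * v * S            ≈⟨ +-congʳ (+-congʳ (*-congʳ (SpeedOf⇒u≈1+uv speed))) ⟩
    (1# + u * v) * S + u * d + u * v * S ≈⟨ solve 4 (λ u v d S → (con 1 :+ u :* v) :* S :+ u :* d :+ u :* v :* S := S :+ u :* (d :+ v :* ((con 1 :+ con 1) :* S))) refl u v d S ⟩
    S + u * (d + v * (2# * S))           ≤⟨ +-monoʳ-≤ S (Catches⇒catchTime≤ speed catches) ⟩
    S + X                                ∎
    where open ≤-Reasoning

  partialSum≈sBefore+ : ∀ x i → partialSum x i ≈ sBefore x i + x i
  partialSum≈sBefore+ x zero    = sym (+-identityˡ (x 0))
  partialSum≈sBefore+ x (suc i) = refl

  partialSum-nonneg : ∀ {x} → (∀ i → 0# ≤ x i) → ∀ i → 0# ≤ partialSum x i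
  partialSum-nonneg 0≤x zero    = 0≤x 0
  partialSum-nonneg 0≤x (suc i) = ≤-trans (partialSum-nonneg 0≤x i) (x≤x+y (0≤x (suc i)))

  sBefore-nonneg : ∀ {x} → (∀ i → 0# ≤ x i) → ∀ i → 0# ≤ sBefore x i
  sBefore-nonneg 0≤x zero    = ≤-refl
  sBefore-nonneg 0≤x (suc i) = partialSum-nonneg 0≤x i

  d*prodUpTo≤partialSum : ∀ {d u x} → 0# ≤ d → (∀ i → 0# ≤ u i) →
    (∀ i → (u i * (sBefore x i + d)) ≤ partialSum x i) →
    ∀ i → (d * prodUpTo u i) ≤ partialSum x i
  d*prodUpTo≤partialSum {d} {u} {x} 0≤d 0≤u step zero = begin
    d * u 0         ≈⟨ *-comm d (u 0) ⟩
    u 0 * d         ≈⟨ *-congˡ (+-identityˡ d) ⟨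
    u 0 * (0# + d)  ≤⟨ step 0 ⟩
    partialSum x 0  ∎
    where open ≤-Reasoning
  d*prodUpTo≤partialSum {d} {u} {x} 0≤d 0≤u step (suc i) = begin
    d * (prodUpTo u i * u (suc i))    ≈⟨ solve 3 (λ d P w → d :* (P :* w) := w :* (d :* P)) refl d (prodUpTo u i) (u (suc i)) ⟩
    u (suc i) * (d * prodUpTo u i)    ≤⟨ *-monoˡ-≤-nonneg (0≤u (suc i)) d*P≤S+d ⟩
    u (suc i) * (partialSum x i + d)  ≤⟨ step (suc i) ⟩
    partialSum x (suc i)              ∎
    where
    open ≤-Reasoning
    d*P≤S+d : (d * prodUpTo u i) ≤ (partialSum x i + d)
    d*P≤S+d = ≤-trans (d*prodUpTo≤partialSum 0≤d 0≤u step i) (x≤x+y 0≤d)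

lemma3 : ∀ {c ℓ₁ ℓ₂} (F : OrderedField c ℓ₁ ℓ₂) →
    let open OrderedField F in
    let open Search F in
    (d : Carrier) → 1# ≤ d →
    (u : ℕ → Carrier) → IsZigzagSequence u →
    (v : ℕ → Carrier) → (∀ i → (0# ≤ v i) × (v i < 1#) × SpeedOf (u i) (v i)) →
    (x : ℕ → Carrier) → (∀ i → IsCatchDistance d (v i) (2# * sBefore x i) (x i)) →
    ∀ i → (d * prodUpTo u i) ≤ partialSum x i
lemma3 F d 1≤d u (1≤u , _) v speeds x catchDistances =
  d*prodUpTo≤partialSum (≤-trans 0≤1 1≤d) 0≤u round
  where
  open OrderedField F hiding (zero)
  open Search F
  open OrderedFieldProperties F
  open ZigzagSearchProperties F

  0≤u : ∀ i → 0# ≤ u i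
  0≤u i = ≤-trans 0≤1 (1≤u i)

  0≤x : ∀ i → 0# ≤ x i
  0≤x i = proj₁ (catchDistances i)

  round : ∀ i → (u i * (sBefore x i + d)) ≤ partialSum x i
  round i with speeds i | catchDistances i
  ... | 0≤v , _ , speed | _ , catches , _ = begin
    u i * (sBefore x i + d)  ≤⟨ u[S+d]≤S+X (0≤u i) 0≤v speed (sBefore-nonneg 0≤x i) catches ⟩
    sBefore x i + x i        ≈⟨ partialSum≈sBefore+ x i ⟨
    partialSum x i           ∎
    where open ≤-Reasoning
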